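{- Let $\mathfrak o_a(v_1)=\{w\in\mathrm{Lie}(V\setminus\{v_0\})\mid w\triangleright_a v_1=0\}$. For all $w\in\mathfrak o_a(v_1)$ and all $b\in\mathrm{Lie}(v_0,v_1)$ we have $\{w,b\}_a=0$.
   Context: $V=\{v_0,v_1,\dots\}$; $\mathrm{Lie}(X)$ denotes the free Lie algebra on $X$, viewed inside $\mathrm{Lie}(V)$. Ari multiplicity $\mathrm m_{\mathbf k,\mathbf l}=(-1)^{|\mathbf k|+|\mathbf l|}\prod_i\binom{k_i-1}{l_i-1}$ ($|\cdot|$ = sum of entries) with $\binom{ -1}{ -1}=1$, $\binom{k-1}{ -1}=\binom{ -1}{l-1}=0$ for $k,l>0$, usual binomials otherwise. $\triangleright_a$ is the post-Lie product on $\mathrm{Lie}(V)$ obtained from the free magma $M(V)$ (product $\star$): for a bracketing $t(\mathbf k)$ of letters $v_{k_1},\dots,v_{k_r}$, $t(\mathbf k)\triangleright_av_0=0$ and $t(\mathbf k)\triangleright_av_s=\sum_{\mathbf l}\mathrm m_{\mathbf k,\mathbf l}v_{s+|\mathbf k|-|\mathbf l|}\star t(\mathbf l)$ for $s\ge1$ ($t(\mathbf l)$ the same bracketing of $v_{l_1},\dots,v_{l_r}$), extended linearly in $t$, as a derivation in the second argument, and descended via $a\star b\mapsto[a,b]$. The ari bracket is the post-Lie bracket $\{x,y\}_a=x\triangleright_ay-y\triangleright_ax+[x,y]$. -}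

module Defs where

open import Data.Nat as ℕ using (ℕ; zero; suc; _∸_; _≤_)
import Data.Nat.Properties as ℕP
open import Data.Nat.Combinatorics using (_C_)
open import Data.Nat.ListAction using (sum)
open import Data.Integer using (+_)
open import Data.Rational using (ℚ; 0ℚ; 1ℚ; _+_; _*_; -_; _/_)
open import Data.List using (List; []; _∷_; _++_; map; concatMap; upTo)
open import Data.List.Properties using (≡-dec)
open import Data.List.Relation.Unary.All using (All)
open import Data.Product using (_×_; _,_; proj₁; proj₂)
open import Relation.Binary.PropositionalEquality using (_≡_)
open import Relation.Nullary.Decidable using (does)
open import Data.Bool using (if_then_else_)

-- The tensor algebra T(V) = ℚ⟨v₀,v₁,…⟩ (letter vᵢ encoded by i : ℕ).
-- A polynomial is a finite formal sum of (coefficient, word); two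
-- polynomials are equal iff all their word-coefficients agree.

Word : Set
Word = List ℕ

Poly : Set
Poly = List (ℚ × Word)

coeff : Poly → Word → ℚ
coeff []            u = 0ℚ
coeff ((c , w) ∷ p) u =
  if does (≡-dec ℕP._≟_ w u) then c + coeff p u else coeff p u

scaleP : ℚ → Poly → Poly
scaleP a = map (λ { (c , w) → (a * c , w) })

negP : Poly → Poly
negP = scaleP (- 1ℚ)

mulP : Poly → Poly → Poly
mulP p q = concatMap (λ { (c , w) → map (λ { (d , u) → (c * d , w ++ u) }) q }) p

-- Bracketings (elements of the free magma M(V)) and Lie expressions.

data Tree : Set where
  leaf : ℕ → Tree
  node : Tree → Tree → Tree

LieExpr : Set
LieExpr = List (ℚ × Tree)

-- realisation of Lie(V) inside T(V): the letter vᵢ ↦ vᵢ and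
-- a ⋆ b ↦ [a,b] = ab - ba
⟦_⟧ᵗ : Tree → Poly
⟦ leaf i ⟧ᵗ   = (1ℚ , i ∷ []) ∷ []
⟦ node a b ⟧ᵗ = mulP ⟦ a ⟧ᵗ ⟦ b ⟧ᵗ ++ negP (mulP ⟦ b ⟧ᵗ ⟦ a ⟧ᵗ)

⟦_⟧ : LieExpr → Poly
⟦ e ⟧ = concatMap (λ { (c , t) → scaleP c ⟦ t ⟧ᵗ }) e

IsZero : LieExpr → Set
IsZero e = ∀ u → coeff ⟦ e ⟧ u ≡ 0ℚ

bracket : LieExpr → LieExpr → LieExpr
bracket x y = concatMap (λ { (a , s) → map (λ { (b , t) → (a * b , node s t) }) y }) x

negE : LieExpr → LieExpr
negE = map (λ { (c , t) → (- c , t) })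

leaves : Tree → List ℕ
leaves (leaf i)   = i ∷ []
leaves (node a b) = leaves a ++ leaves b

relabel′ : Tree → List ℕ → Tree × List ℕ
relabel′ (leaf i)   []       = leaf i , []
relabel′ (leaf i)   (l ∷ ls) = leaf l , ls
relabel′ (node a b) ls with relabel′ a ls
... | a′ , ls′ with relabel′ b ls′
... | b′ , ls″ = node a′ b′ , ls″

relabel : Tree → List ℕ → Tree
relabel t ls = proj₁ (relabel′ t ls)

-- binom(k-1, l-1) with binom(-1,-1) = 1, binom(k-1,-1) = binom(-1,l-1) = 0
binomA : ℕ → ℕ → ℕ
binomA zero    zero    = 1
binomA zero    (suc l) = 0
binomA (suc k) zero    = 0
binomA (suc k) (suc l) = k C l

total : List ℕ → ℕ
total = sum

sign : ℕ → ℚ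
sign zero          = 1ℚ
sign (suc zero)    = - 1ℚ
sign (suc (suc n)) = sign n

prodBinom : List ℕ → List ℕ → ℕ
prodBinom (k ∷ ks) (l ∷ ls) = binomA k l ℕ.* prodBinom ks ls
prodBinom _        _        = 1

-- m_{k,l} (for tuples of equal length)
mult : List ℕ → List ℕ → ℚ
mult ks ls = sign (total ks ℕ.+ total ls) * ((+ prodBinom ks ls) / 1)

-- all tuples l with lᵢ ≤ kᵢ (this contains the support of m_{k,-})
tuples : List ℕ → List (List ℕ)
tuples []       = [] ∷ []
tuples (k ∷ ks) = concatMap (λ l → map (l ∷_) (tuples ks)) (upTo (suc k))

triT : Tree → Tree → LieExpr
triT t (leaf zero)    = []
triT t (leaf (suc s)) =
  map (λ l → (mult k l , node (leaf (suc s ℕ.+ total k ∸ total l)) (relabel t l)))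
      (tuples k)
  where k = leaves t
triT t (node y z) =
  bracket (triT t y) ((1ℚ , z) ∷ []) ++ bracket ((1ℚ , y) ∷ []) (triT t z)

_▷ₐ_ : LieExpr → LieExpr → LieExpr
x ▷ₐ y = concatMap (λ { (a , s) →
           concatMap (λ { (b , t) → map (λ { (c , r) → (a * b * c , r) }) (triT s t) }) y }) x

ari : LieExpr → LieExpr → LieExpr
ari x y = (x ▷ₐ y) ++ negE (y ▷ₐ x) ++ bracket x y

-- Subalgebras generated by sets of letters (membership via a
-- representative built from those letters only).

InLieNoV0 : LieExpr → Set
InLieNoV0 w = All (λ ct → All (λ i → 1 ≤ i) (leaves (proj₂ ct))) w

InLieV0V1 : LieExpr → Set
InLieV0V1 b = All (λ ct → All (λ i → i ≤ 1) (leaves (proj₂ ct))) b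

v₁ : LieExpr
v₁ = (1ℚ , leaf 1) ∷ []

-- Everything is computed in the algebra of noncommutative power series ℚ⟨⟨V⟩⟩, where a
-- bracketing becomes an iterated commutator. If all letters of a bracketing s are v₀ or v₁,
-- every binomial in the ari multiplicity vanishes except for l = k, so s ▷ₐ vᵢ = [vᵢ, s] for
-- i ≥ 1. Both s ▷ₐ_ and [_, s] (by Jacobi) are derivations, hence b ▷ₐ w = [w, b] for
-- b ∈ Lie(v₀, v₁) and w ∈ Lie(V ∖ {v₀}). Dually, w ▷ₐ_ is a derivation killing v₀ (by
-- definition) and v₁ (by hypothesis), hence all of Lie(v₀, v₁). So {w, b}ₐ = 0 − [w, b] + [w, b].

module Submission where

open import Defs
open import Data.Nat as ℕ using (ℕ; zero; suc; _∸_; _≤_; s≤s)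
import Data.Nat.Properties as ℕP
open import Data.Integer using () renaming (+_ to ℤ+_)
open import Data.Rational using (ℚ; 0ℚ; 1ℚ; _+_; _*_; -_; _/_)
import Data.Rational.Properties as ℚP
open import Data.List using (List; []; _∷_; _++_; map; concatMap)
open import Data.List.Properties using (≡-dec; ++-assoc; ++-identityʳ; concatMap-++)
open import Data.List.Relation.Unary.All using (All; []; _∷_)
open import Data.List.Relation.Unary.All.Properties using (++⁻ˡ; ++⁻ʳ)
open import Data.Bool using (true; false; if_then_else_)
open import Data.Product using (_×_; _,_; proj₁; proj₂)
open import Function using (_∘_)
open import Relation.Nullary.Decidable using (does; dec⇒maybe)
open import Relation.Binary.PropositionalEquality
import Relation.Binary.Reasoning.Setoid as SetoidReasoning
import Tactic.RingSolver.Core.AlmostCommutativeRing as ACR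
open import Tactic.RingSolver using (solve-∀)

ℚ-ring : ACR.AlmostCommutativeRing _ _
ℚ-ring = ACR.fromCommutativeRing ℚP.+-*-commutativeRing (λ x → dec⇒maybe (0ℚ ℚP.≟ x))

-- Formal power series

Series : Set
Series = Word → ℚ

module ≗-Reasoning = SetoidReasoning (Word →-setoid ℚ)

infixl 6 _⊕_
infixr 7 _∙_
infixl 8 _·_

𝟘 : Series
𝟘 _ = 0ℚ

_⊕_ : Series → Series → Series
(f ⊕ g) u = f u + g u

_∙_ : ℚ → Series → Series
(a ∙ f) u = a * f u

⊕-cong : ∀ {f f′ g g′} → f ≗ f′ → g ≗ g′ → f ⊕ g ≗ f′ ⊕ g′
⊕-cong p q u = cong₂ _+_ (p u) (q u)

⊕-congˡ : ∀ f {g g′} → g ≗ g′ → f ⊕ g ≗ f ⊕ g′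
⊕-congˡ f = ⊕-cong {f = f} (λ _ → refl)

∙-congˡ : ∀ a {f g} → f ≗ g → a ∙ f ≗ a ∙ g
∙-congˡ a p u = cong (a *_) (p u)

1∙f⊕𝟘≗f : ∀ f → 1ℚ ∙ f ⊕ 𝟘 ≗ f
1∙f⊕𝟘≗f f u = one-unit (f u)
  where
  one-unit : ∀ x → 1ℚ * x + 0ℚ ≡ x
  one-unit = solve-∀ ℚ-ring

shift : ℕ → Series → Series
shift x f v = f (x ∷ v)

-- (f · g) u = Σ_{v w = u} f v * g w, computed by moving the first letter of u into the left factor.
_·_ : Series → Series → Series
(f · g) []      = f [] * g []
(f · g) (x ∷ u) = f [] * g (x ∷ u) + (shift x f · g) u

·-cong : ∀ {f f′ g g′} → f ≗ f′ → g ≗ g′ → f · g ≗ f′ · g′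
·-cong p q []      = cong₂ _*_ (p []) (q [])
·-cong p q (x ∷ u) = cong₂ _+_ (cong₂ _*_ (p []) (q (x ∷ u))) (·-cong (λ v → p (x ∷ v)) q u)

record IsLinear (L : Series → Series) : Set where
  field
    𝟘-homo : L 𝟘 ≗ 𝟘
    ⊕-homo : ∀ f g → L (f ⊕ g) ≗ L f ⊕ L g
    ∙-homo : ∀ a f → L (a ∙ f) ≗ a ∙ L f

·-linearˡ : ∀ g → IsLinear (_· g)
·-linearˡ g = record { 𝟘-homo = annihilate ; ⊕-homo = distrib ; ∙-homo = scale }
  where
  annihilate : 𝟘 · g ≗ 𝟘
  annihilate []      = ℚP.*-zeroˡ (g [])
  annihilate (x ∷ u) = cong₂ _+_ (ℚP.*-zeroˡ (g (x ∷ u))) (annihilate u)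

  interchange : ∀ p p′ G R R′ → (p + p′) * G + (R + R′) ≡ (p * G + R) + (p′ * G + R′)
  interchange = solve-∀ ℚ-ring

  distrib : ∀ f f′ → (f ⊕ f′) · g ≗ f · g ⊕ f′ · g
  distrib f f′ []      = ℚP.*-distribʳ-+ (g []) (f []) (f′ [])
  distrib f f′ (x ∷ u) = trans (cong ((f [] + f′ []) * g (x ∷ u) +_) (distrib (shift x f) (shift x f′) u))
                               (interchange (f []) (f′ []) (g (x ∷ u)) _ _)

  pull : ∀ a p G R → (a * p) * G + a * R ≡ a * (p * G + R)
  pull = solve-∀ ℚ-ring

  scale : ∀ a f → (a ∙ f) · g ≗ a ∙ (f · g)
  scale a f []      = ℚP.*-assoc a (f []) (g [])
  scale a f (x ∷ u) = trans (cong ((a * f []) * g (x ∷ u) +_) (scale a (shift x f) u)) (pull a (f []) (g (x ∷ u)) _)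

·-linearʳ : ∀ f → IsLinear (f ·_)
·-linearʳ f = record { 𝟘-homo = annihilate f ; ⊕-homo = distrib f ; ∙-homo = λ a g → scale a f g }
  where
  annihilate : ∀ f → f · 𝟘 ≗ 𝟘
  annihilate f []      = ℚP.*-zeroʳ (f [])
  annihilate f (x ∷ u) = cong₂ _+_ (ℚP.*-zeroʳ (f [])) (annihilate (shift x f) u)

  interchange : ∀ p G G′ R R′ → p * (G + G′) + (R + R′) ≡ (p * G + R) + (p * G′ + R′)
  interchange = solve-∀ ℚ-ring

  distrib : ∀ f g g′ → f · (g ⊕ g′) ≗ f · g ⊕ f · g′
  distrib f g g′ []      = ℚP.*-distribˡ-+ (f []) (g []) (g′ [])
  distrib f g g′ (x ∷ u) = trans (cong (f [] * (g (x ∷ u) + g′ (x ∷ u)) +_) (distrib (shift x f) g g′ u))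
                                 (interchange (f []) (g (x ∷ u)) (g′ (x ∷ u)) _ _)

  commute : ∀ p a G → p * (a * G) ≡ a * (p * G)
  commute = solve-∀ ℚ-ring

  pull : ∀ a p G R → p * (a * G) + a * R ≡ a * (p * G + R)
  pull = solve-∀ ℚ-ring

  scale : ∀ a f g → f · (a ∙ g) ≗ a ∙ (f · g)
  scale a f g []      = commute (f []) a (g [])
  scale a f g (x ∷ u) = trans (cong (f [] * (a * g (x ∷ u)) +_) (scale a (shift x f) g u)) (pull a (f []) (g (x ∷ u)) _)

·-assoc : ∀ f g h → (f · g) · h ≗ f · (g · h)
·-assoc f g h []      = ℚP.*-assoc (f []) (g []) (h [])
·-assoc f g h (x ∷ u) = begin
  (f [] * g []) * h (x ∷ u) + ((f [] ∙ shift x g ⊕ shift x f · g) · h) u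
    ≡⟨ cong ((f [] * g []) * h (x ∷ u) +_) (trans (⊕-homo (f [] ∙ shift x g) (shift x f · g) u)
                          (cong₂ _+_ (∙-homo (f []) (shift x g) u) (·-assoc (shift x f) g h u))) ⟩
  (f [] * g []) * h (x ∷ u) + (f [] * (shift x g · h) u + (shift x f · (g · h)) u)
    ≡⟨ regroup (f []) (g []) (h (x ∷ u)) _ _ ⟩
  f [] * (g · h) (x ∷ u) + (shift x f · (g · h)) u ∎
  where
  open IsLinear (·-linearˡ h)
  open ≡-Reasoning
  regroup : ∀ p q H A B → (p * q) * H + (p * A + B) ≡ p * (q * H + A) + B
  regroup = solve-∀ ℚ-ring

isLinear-⊕ : ∀ {L L′} → IsLinear L → IsLinear L′ → IsLinear (λ f → L f ⊕ L′ f)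
isLinear-⊕ {L} {L′} isL isL′ = record
  { 𝟘-homo = λ u → cong₂ _+_ (L.𝟘-homo u) (L′.𝟘-homo u)
  ; ⊕-homo = λ f g u → trans (cong₂ _+_ (L.⊕-homo f g u) (L′.⊕-homo f g u))
                             (interchange (L f u) (L g u) (L′ f u) (L′ g u))
  ; ∙-homo = λ a f u → trans (cong₂ _+_ (L.∙-homo a f u) (L′.∙-homo a f u))
                             (sym (ℚP.*-distribˡ-+ a (L f u) (L′ f u)))
  }
  where
  module L = IsLinear isL
  module L′ = IsLinear isL′
  interchange : ∀ a b c d → (a + b) + (c + d) ≡ (a + c) + (b + d)
  interchange = solve-∀ ℚ-ring

isLinear-∙ : ∀ a {L} → IsLinear L → IsLinear (λ f → a ∙ L f)
isLinear-∙ a {L} isL = record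
  { 𝟘-homo = λ u → trans (cong (a *_) (𝟘-homo u)) (ℚP.*-zeroʳ a)
  ; ⊕-homo = λ f g u → trans (cong (a *_) (⊕-homo f g u)) (ℚP.*-distribˡ-+ a (L f u) (L g u))
  ; ∙-homo = λ b f u → trans (cong (a *_) (∙-homo b f u)) (commute a b (L f u))
  }
  where
  open IsLinear isL
  commute : ∀ a b x → a * (b * x) ≡ b * (a * x)
  commute = solve-∀ ℚ-ring

⁅_,_⁆ : Series → Series → Series
⁅ f , g ⁆ = f · g ⊕ (- 1ℚ) ∙ (g · f)

⁅⁆-cong : ∀ {f f′ g g′} → f ≗ f′ → g ≗ g′ → ⁅ f , g ⁆ ≗ ⁅ f′ , g′ ⁆
⁅⁆-cong p q = ⊕-cong (·-cong p q) (∙-congˡ (- 1ℚ) (·-cong q p))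

⁅⁆-linearˡ : ∀ g → IsLinear (λ f → ⁅ f , g ⁆)
⁅⁆-linearˡ g = isLinear-⊕ (·-linearˡ g) (isLinear-∙ (- 1ℚ) (·-linearʳ g))

⁅⁆-linearʳ : ∀ f → IsLinear (λ g → ⁅ f , g ⁆)
⁅⁆-linearʳ f = isLinear-⊕ (·-linearʳ f) (isLinear-∙ (- 1ℚ) (·-linearˡ f))

⁅⁆-·ˡ : ∀ f g h → ⁅ f , g ⁆ · h ≗ f · (g · h) ⊕ (- 1ℚ) ∙ (g · (f · h))
⁅⁆-·ˡ f g h = begin
  ⁅ f , g ⁆ · h                         ≈⟨ ⊕-homo (f · g) ((- 1ℚ) ∙ (g · f)) ⟩
  (f · g) · h ⊕ ((- 1ℚ) ∙ (g · f)) · h  ≈⟨ ⊕-cong (·-assoc f g h) (∙-homo (- 1ℚ) (g · f)) ⟩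
  f · (g · h) ⊕ (- 1ℚ) ∙ ((g · f) · h)  ≈⟨ ⊕-congˡ (f · (g · h)) (∙-congˡ (- 1ℚ) (·-assoc g f h)) ⟩
  f · (g · h) ⊕ (- 1ℚ) ∙ (g · (f · h))  ∎
  where
  open IsLinear (·-linearˡ h)
  open ≗-Reasoning

⁅⁆-·ʳ : ∀ f g h → h · ⁅ f , g ⁆ ≗ h · (f · g) ⊕ (- 1ℚ) ∙ (h · (g · f))
⁅⁆-·ʳ f g h u = trans (⊕-homo (f · g) ((- 1ℚ) ∙ (g · f)) u)
                      (cong ((h · (f · g)) u +_) (∙-homo (- 1ℚ) (g · f) u))
  where open IsLinear (·-linearʳ h)

⁅⁆-jacobi : ∀ f g h → ⁅ ⁅ f , g ⁆ , h ⁆ ≗ ⁅ ⁅ f , h ⁆ , g ⁆ ⊕ ⁅ f , ⁅ g , h ⁆ ⁆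
⁅⁆-jacobi f g h u = begin
  ⁅ ⁅ f , g ⁆ , h ⁆ u                                 ≡⟨ expand f g h u ⟩
  (fgh - gfh) - (hfg - hgf)                           ≡⟨ six-terms fgh gfh hfg hgf fhg ghf ⟩
  ((fhg - hfg) - (gfh - ghf)) + ((fgh - fhg) - (ghf - hgf))
    ≡⟨ sym (cong₂ _+_ (expand f h g u) (⊕-cong (⁅⁆-·ʳ g h f) (∙-congˡ (- 1ℚ) (⁅⁆-·ˡ g h f)) u)) ⟩
  (⁅ ⁅ f , h ⁆ , g ⁆ ⊕ ⁅ f , ⁅ g , h ⁆ ⁆) u          ∎
  where
  open ≡-Reasoning
  _-_ : ℚ → ℚ → ℚ
  a - b = a + (- 1ℚ) * b
  fgh gfh hfg hgf fhg ghf : ℚ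
  fgh = (f · (g · h)) u
  gfh = (g · (f · h)) u
  hfg = (h · (f · g)) u
  hgf = (h · (g · f)) u
  fhg = (f · (h · g)) u
  ghf = (g · (h · f)) u
  expand : ∀ f g h → ⁅ ⁅ f , g ⁆ , h ⁆ ≗
           (f · (g · h) ⊕ (- 1ℚ) ∙ (g · (f · h))) ⊕ (- 1ℚ) ∙ (h · (f · g) ⊕ (- 1ℚ) ∙ (h · (g · f)))
  expand f g h = ⊕-cong (⁅⁆-·ˡ f g h) (∙-congˡ (- 1ℚ) (⁅⁆-·ʳ f g h))
  six-terms : ∀ A B C D E F →
              (A + (- 1ℚ) * B) + (- 1ℚ) * (C + (- 1ℚ) * D)
              ≡ ((E + (- 1ℚ) * C) + (- 1ℚ) * (B + (- 1ℚ) * F)) + ((A + (- 1ℚ) * E) + (- 1ℚ) * (F + (- 1ℚ) * D))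
  six-terms = solve-∀ ℚ-ring

monomial : Word → ℚ → Series
monomial w c u = if does (≡-dec ℕP._≟_ w u) then c else 0ℚ

coeff-∷ : ∀ c w p → coeff ((c , w) ∷ p) ≗ monomial w c ⊕ coeff p
coeff-∷ c w p u with does (≡-dec ℕP._≟_ w u)
... | true  = refl
... | false = sym (ℚP.+-identityˡ (coeff p u))

monomial-∙ : ∀ a w c → monomial w (a * c) ≗ a ∙ monomial w c
monomial-∙ a w c u with does (≡-dec ℕP._≟_ w u)
... | true  = refl
... | false = sym (ℚP.*-zeroʳ a)

monomial-· : ∀ w v c d → monomial (w ++ v) (c * d) ≗ monomial w c · monomial v d
monomial-· []      v c d []      = monomial-∙ c v d []
monomial-· []      v c d (x ∷ u) =
  trans (monomial-∙ c v d (x ∷ u))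
        (sym (trans (cong (c * monomial v d (x ∷ u) +_) (IsLinear.𝟘-homo (·-linearˡ (monomial v d)) u))
                    (ℚP.+-identityʳ _)))
monomial-· (y ∷ w) v c d []      = sym (ℚP.*-zeroˡ (monomial v d []))
monomial-· (y ∷ w) v c d (x ∷ u) with y ℕ.≡ᵇ x
... | true  = trans (monomial-· w v c d u)
                    (sym (trans (cong (_+ (monomial w c · monomial v d) u) (ℚP.*-zeroˡ (monomial v d (x ∷ u))))
                                (ℚP.+-identityˡ _)))
... | false = sym (trans (cong₂ _+_ (ℚP.*-zeroˡ (monomial v d (x ∷ u)))
                                    (IsLinear.𝟘-homo (·-linearˡ (monomial v d)) u))
                         (ℚP.+-identityˡ 0ℚ))

coeff-++ : ∀ p q → coeff (p ++ q) ≗ coeff p ⊕ coeff q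
coeff-++ []            q u = sym (ℚP.+-identityˡ (coeff q u))
coeff-++ ((c , w) ∷ p) q u = begin
  coeff ((c , w) ∷ p ++ q) u                ≡⟨ coeff-∷ c w (p ++ q) u ⟩
  monomial w c u + coeff (p ++ q) u         ≡⟨ cong (monomial w c u +_) (coeff-++ p q u) ⟩
  monomial w c u + (coeff p u + coeff q u)  ≡⟨ ℚP.+-assoc (monomial w c u) (coeff p u) (coeff q u) ⟨
  (monomial w c u + coeff p u) + coeff q u  ≡⟨ cong (_+ coeff q u) (coeff-∷ c w p u) ⟨
  coeff ((c , w) ∷ p) u + coeff q u         ∎
  where open ≡-Reasoning

coeff-scaleP : ∀ a p → coeff (scaleP a p) ≗ a ∙ coeff p
coeff-scaleP a []            u = sym (ℚP.*-zeroʳ a)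
coeff-scaleP a ((c , w) ∷ p) u = begin
  coeff ((a * c , w) ∷ scaleP a p) u                 ≡⟨ coeff-∷ (a * c) w (scaleP a p) u ⟩
  monomial w (a * c) u + coeff (scaleP a p) u        ≡⟨ cong₂ _+_ (monomial-∙ a w c u) (coeff-scaleP a p u) ⟩
  a * monomial w c u + a * coeff p u                 ≡⟨ ℚP.*-distribˡ-+ a (monomial w c u) (coeff p u) ⟨
  a * (monomial w c u + coeff p u)                   ≡⟨ cong (a *_) (coeff-∷ c w p u) ⟨
  a * coeff ((c , w) ∷ p) u                          ∎
  where open ≡-Reasoning

mulTerm : ℚ → Word → ℚ × Word → ℚ × Word
mulTerm c w (d , v) = (c * d , w ++ v)

coeff-mulP-monomial : ∀ c w q → coeff (map (mulTerm c w) q) ≗ monomial w c · coeff q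
coeff-mulP-monomial c w []            u = sym (IsLinear.𝟘-homo (·-linearʳ (monomial w c)) u)
coeff-mulP-monomial c w ((d , v) ∷ q) = begin
  coeff ((c * d , w ++ v) ∷ map (mulTerm c w) q)
    ≈⟨ coeff-∷ (c * d) (w ++ v) (map (mulTerm c w) q) ⟩
  monomial (w ++ v) (c * d) ⊕ coeff (map (mulTerm c w) q)
    ≈⟨ ⊕-cong (monomial-· w v c d) (coeff-mulP-monomial c w q) ⟩
  monomial w c · monomial v d ⊕ monomial w c · coeff q
    ≈⟨ IsLinear.⊕-homo (·-linearʳ (monomial w c)) (monomial v d) (coeff q) ⟨
  monomial w c · (monomial v d ⊕ coeff q)
    ≈⟨ ·-cong {f = monomial w c} (λ _ → refl) (coeff-∷ d v q) ⟨
  monomial w c · coeff ((d , v) ∷ q) ∎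
  where open ≗-Reasoning

coeff-mulP : ∀ p q → coeff (mulP p q) ≗ coeff p · coeff q
coeff-mulP []            q u = sym (IsLinear.𝟘-homo (·-linearˡ (coeff q)) u)
coeff-mulP ((c , w) ∷ p) q = begin
  coeff (map (mulTerm c w) q ++ mulP p q)
    ≈⟨ coeff-++ (map (mulTerm c w) q) (mulP p q) ⟩
  coeff (map (mulTerm c w) q) ⊕ coeff (mulP p q)
    ≈⟨ ⊕-cong (coeff-mulP-monomial c w q) (coeff-mulP p q) ⟩
  monomial w c · coeff q ⊕ coeff p · coeff q
    ≈⟨ IsLinear.⊕-homo (·-linearˡ (coeff q)) (monomial w c) (coeff p) ⟨
  (monomial w c ⊕ coeff p) · coeff q
    ≈⟨ ·-cong {g = coeff q} (coeff-∷ c w p) (λ _ → refl) ⟨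
  coeff ((c , w) ∷ p) · coeff q ∎
  where open ≗-Reasoning

-- Lie expressions as series

⟪_⟫ᵗ : Tree → Series
⟪ t ⟫ᵗ = coeff ⟦ t ⟧ᵗ

⟪_⟫ : LieExpr → Series
⟪ e ⟫ = coeff ⟦ e ⟧

⟪node⟫ : ∀ a b → ⟪ node a b ⟫ᵗ ≗ ⁅ ⟪ a ⟫ᵗ , ⟪ b ⟫ᵗ ⁆
⟪node⟫ a b = begin
  coeff (mulP ⟦ a ⟧ᵗ ⟦ b ⟧ᵗ ++ negP (mulP ⟦ b ⟧ᵗ ⟦ a ⟧ᵗ))
    ≈⟨ coeff-++ (mulP ⟦ a ⟧ᵗ ⟦ b ⟧ᵗ) (negP (mulP ⟦ b ⟧ᵗ ⟦ a ⟧ᵗ)) ⟩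
  coeff (mulP ⟦ a ⟧ᵗ ⟦ b ⟧ᵗ) ⊕ coeff (negP (mulP ⟦ b ⟧ᵗ ⟦ a ⟧ᵗ))
    ≈⟨ ⊕-cong (coeff-mulP ⟦ a ⟧ᵗ ⟦ b ⟧ᵗ) (λ u → trans (coeff-scaleP (- 1ℚ) (mulP ⟦ b ⟧ᵗ ⟦ a ⟧ᵗ) u)
                                                      (cong ((- 1ℚ) *_) (coeff-mulP ⟦ b ⟧ᵗ ⟦ a ⟧ᵗ u))) ⟩
  ⁅ ⟪ a ⟫ᵗ , ⟪ b ⟫ᵗ ⁆ ∎
  where open ≗-Reasoning

⟪⟫-∷ : ∀ c t e → ⟪ (c , t) ∷ e ⟫ ≗ c ∙ ⟪ t ⟫ᵗ ⊕ ⟪ e ⟫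
⟪⟫-∷ c t e u = trans (coeff-++ (scaleP c ⟦ t ⟧ᵗ) ⟦ e ⟧ u) (cong (_+ ⟪ e ⟫ u) (coeff-scaleP c ⟦ t ⟧ᵗ u))

⟪⟫-++ : ∀ e e′ → ⟪ e ++ e′ ⟫ ≗ ⟪ e ⟫ ⊕ ⟪ e′ ⟫
⟪⟫-++ e e′ u = trans (cong (λ p → coeff p u) (concatMap-++ _ e e′)) (coeff-++ ⟦ e ⟧ ⟦ e′ ⟧ u)

∑ : ∀ {A : Set} → List A → (A → Series) → Series
∑ []       φ = 𝟘
∑ (x ∷ xs) φ = φ x ⊕ ∑ xs φ

∑-cong : ∀ {A : Set} xs {φ ψ : A → Series} → (∀ x → φ x ≗ ψ x) → ∑ xs φ ≗ ∑ xs ψ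
∑-cong []       p u = refl
∑-cong (x ∷ xs) p   = ⊕-cong (p x) (∑-cong xs p)

∑-++ : ∀ {A : Set} xs ys (φ : A → Series) → ∑ (xs ++ ys) φ ≗ ∑ xs φ ⊕ ∑ ys φ
∑-++ []       ys φ u = sym (ℚP.+-identityˡ _)
∑-++ (x ∷ xs) ys φ u = trans (cong (φ x u +_) (∑-++ xs ys φ u)) (sym (ℚP.+-assoc (φ x u) _ _))

∑-map : ∀ {A B : Set} (g : A → B) xs (φ : B → Series) → ∑ (map g xs) φ ≗ ∑ xs (λ x → φ (g x))
∑-map g []       φ u = refl
∑-map g (x ∷ xs) φ   = ⊕-congˡ (φ (g x)) (∑-map g xs φ)

⟪⟫-concatMap : ∀ {A : Set} (F : A → LieExpr) xs → ⟪ concatMap F xs ⟫ ≗ ∑ xs (λ x → ⟪ F x ⟫)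
⟪⟫-concatMap F []       u = refl
⟪⟫-concatMap F (x ∷ xs) u =
  trans (⟪⟫-++ (F x) (concatMap F xs) u) (cong (⟪ F x ⟫ u +_) (⟪⟫-concatMap F xs u))

extend : LieExpr → (Tree → Series) → Series
extend e φ = ∑ e (λ (c , t) → c ∙ φ t)

⟪⟫-extend : ∀ e → ⟪ e ⟫ ≗ extend e ⟪_⟫ᵗ
⟪⟫-extend []            u = refl
⟪⟫-extend ((c , t) ∷ e) u = trans (⟪⟫-∷ c t e u) (cong (c * ⟪ t ⟫ᵗ u +_) (⟪⟫-extend e u))

⟪⟫-map : ∀ {A : Set} (g : A → ℚ × Tree) xs →
         ⟪ map g xs ⟫ ≗ ∑ xs (λ x → proj₁ (g x) ∙ ⟪ proj₂ (g x) ⟫ᵗ)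
⟪⟫-map g xs u = trans (⟪⟫-extend (map g xs) u) (∑-map g xs _ u)

extend-cong : ∀ e {φ ψ} → (∀ t → φ t ≗ ψ t) → extend e φ ≗ extend e ψ
extend-cong e p = ∑-cong e (λ (c , t) → ∙-congˡ c (p t))

extend-cong-All : ∀ {P : Tree → Set} e {φ ψ} → All (P ∘ proj₂) e → (∀ {t} → P t → φ t ≗ ψ t) →
                  extend e φ ≗ extend e ψ
extend-cong-All []            []         p u = refl
extend-cong-All ((c , t) ∷ e) (pt ∷ pe) p   = ⊕-cong (∙-congˡ c (p pt)) (extend-cong-All e pe p)

extend-commute : ∀ {L} → IsLinear L → ∀ e φ → L (extend e φ) ≗ extend e (λ t → L (φ t))
extend-commute isL []            φ = 𝟘-homo
  where open IsLinear isL
extend-commute {L} isL ((c , t) ∷ e) φ = begin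
  L (c ∙ φ t ⊕ extend e φ)      ≈⟨ ⊕-homo (c ∙ φ t) (extend e φ) ⟩
  L (c ∙ φ t) ⊕ L (extend e φ)  ≈⟨ ⊕-cong (∙-homo c (φ t)) (extend-commute isL e φ) ⟩
  c ∙ L (φ t) ⊕ extend e (λ t → L (φ t)) ∎
  where
  open IsLinear isL
  open ≗-Reasoning

extend-𝟘 : ∀ e → extend e (λ _ → 𝟘) ≗ 𝟘
extend-𝟘 []            u = refl
extend-𝟘 ((c , t) ∷ e) u = cong₂ _+_ (ℚP.*-zeroʳ c) (extend-𝟘 e u)

extend-⊕ : ∀ e φ ψ → extend e (λ t → φ t ⊕ ψ t) ≗ extend e φ ⊕ extend e ψ
extend-⊕ []            φ ψ u = refl
extend-⊕ ((c , t) ∷ e) φ ψ u =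
  trans (cong₂ _+_ (ℚP.*-distribˡ-+ c (φ t u) (ψ t u)) (extend-⊕ e φ ψ u))
        (interchange (c * φ t u) (c * ψ t u) (extend e φ u) (extend e ψ u))
  where
  interchange : ∀ a b c d → (a + b) + (c + d) ≡ (a + c) + (b + d)
  interchange = solve-∀ ℚ-ring

∙-*-comm : ∀ a b f → (a * b) ∙ f ≗ b ∙ (a ∙ f)
∙-*-comm a b f u = commute a b (f u)
  where
  commute : ∀ a b x → (a * b) * x ≡ b * (a * x)
  commute = solve-∀ ℚ-ring

extend-∙ : ∀ a e φ → extend e (λ t → a ∙ φ t) ≗ a ∙ extend e φ
extend-∙ a []            φ u = sym (ℚP.*-zeroʳ a)
extend-∙ a ((c , t) ∷ e) φ u =
  trans (cong (c * (a * φ t u) +_) (extend-∙ a e φ u)) (pull a c (φ t u) (extend e φ u))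
  where
  pull : ∀ a c x r → c * (a * x) + a * r ≡ a * (c * x + r)
  pull = solve-∀ ℚ-ring

extend-swap : ∀ x y (Φ : Tree → Tree → Series) →
              extend x (λ s → extend y (Φ s)) ≗ extend y (λ t → extend x (λ s → Φ s t))
extend-swap x []            Φ = extend-𝟘 x
extend-swap x ((b , t) ∷ y) Φ = begin
  extend x (λ s → b ∙ Φ s t ⊕ extend y (Φ s))
    ≈⟨ extend-⊕ x (λ s → b ∙ Φ s t) (λ s → extend y (Φ s)) ⟩
  extend x (λ s → b ∙ Φ s t) ⊕ extend x (λ s → extend y (Φ s))
    ≈⟨ ⊕-cong (extend-∙ b x (λ s → Φ s t)) (extend-swap x y Φ) ⟩
  b ∙ extend x (λ s → Φ s t) ⊕ extend y (λ t → extend x (λ s → Φ s t)) ∎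
  where open ≗-Reasoning

∑∑-extend : ∀ x y (Φ : Tree → Tree → Series) →
            ∑ x (λ (a , s) → ∑ y (λ (b , t) → (a * b) ∙ Φ s t)) ≗ extend x (λ s → extend y (Φ s))
∑∑-extend x y Φ = ∑-cong x λ (a , s) u →
  trans (∑-cong y (λ (b , t) → ∙-*-comm a b (Φ s t)) u) (extend-∙ a y (Φ s) u)

⟪bracket⟫ : ∀ x y → ⟪ bracket x y ⟫ ≗ ⁅ ⟪ x ⟫ , ⟪ y ⟫ ⁆
⟪bracket⟫ x y = begin
  ⟪ bracket x y ⟫
    ≈⟨ ⟪⟫-concatMap (λ (a , s) → map (λ (b , t) → (a * b , node s t)) y) x ⟩
  ∑ x (λ (a , s) → ⟪ map (λ (b , t) → (a * b , node s t)) y ⟫)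
    ≈⟨ ∑-cong x (λ (a , s) → ⟪⟫-map (λ (b , t) → (a * b , node s t)) y) ⟩
  ∑ x (λ (a , s) → ∑ y (λ (b , t) → (a * b) ∙ ⟪ node s t ⟫ᵗ))
    ≈⟨ ∑∑-extend x y (λ s t → ⟪ node s t ⟫ᵗ) ⟩
  extend x (λ s → extend y (λ t → ⟪ node s t ⟫ᵗ))
    ≈⟨ extend-cong x (λ s → extend-cong y (⟪node⟫ s)) ⟩
  extend x (λ s → extend y (λ t → ⁅ ⟪ s ⟫ᵗ , ⟪ t ⟫ᵗ ⁆))
    ≈⟨ extend-cong x (λ s → extend-commute (⁅⁆-linearʳ ⟪ s ⟫ᵗ) y ⟪_⟫ᵗ) ⟨
  extend x (λ s → ⁅ ⟪ s ⟫ᵗ , extend y ⟪_⟫ᵗ ⁆)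
    ≈⟨ extend-commute (⁅⁆-linearˡ (extend y ⟪_⟫ᵗ)) x ⟪_⟫ᵗ ⟨
  ⁅ extend x ⟪_⟫ᵗ , extend y ⟪_⟫ᵗ ⁆
    ≈⟨ ⁅⁆-cong (⟪⟫-extend x) (⟪⟫-extend y) ⟨
  ⁅ ⟪ x ⟫ , ⟪ y ⟫ ⁆ ∎
  where open ≗-Reasoning

⟪⟫-rescale : ∀ k (g : ℚ → ℚ) → (∀ c → g c ≡ k * c) →
             ∀ e → ⟪ map (λ (c , t) → (g c , t)) e ⟫ ≗ k ∙ ⟪ e ⟫
⟪⟫-rescale k g g≡k* e = begin
  ⟪ map (λ (c , t) → (g c , t)) e ⟫  ≈⟨ ⟪⟫-map (λ (c , t) → (g c , t)) e ⟩
  ∑ e (λ (c , t) → g c ∙ ⟪ t ⟫ᵗ)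
    ≈⟨ ∑-cong e (λ (c , t) u → trans (cong (_* ⟪ t ⟫ᵗ u) (g≡k* c)) (∙-*-comm k c ⟪ t ⟫ᵗ u)) ⟩
  extend e (λ t → k ∙ ⟪ t ⟫ᵗ)        ≈⟨ extend-∙ k e ⟪_⟫ᵗ ⟩
  k ∙ extend e ⟪_⟫ᵗ                  ≈⟨ ∙-congˡ k (⟪⟫-extend e) ⟨
  k ∙ ⟪ e ⟫                          ∎
  where open ≗-Reasoning

_▷ᵗ_ : LieExpr → Tree → Series
x ▷ᵗ t = extend x (λ s → ⟪ triT s t ⟫)

⟪▷ₐ⟫ : ∀ x y → ⟪ x ▷ₐ y ⟫ ≗ extend y (x ▷ᵗ_)
⟪▷ₐ⟫ x y = begin
  ⟪ x ▷ₐ y ⟫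
    ≈⟨ ⟪⟫-concatMap (λ (a , s) → concatMap (λ (b , t) → rescaled (a * b) (triT s t)) y) x ⟩
  ∑ x (λ (a , s) → ⟪ concatMap (λ (b , t) → rescaled (a * b) (triT s t)) y ⟫)
    ≈⟨ ∑-cong x (λ (a , s) → ⟪⟫-concatMap (λ (b , t) → rescaled (a * b) (triT s t)) y) ⟩
  ∑ x (λ (a , s) → ∑ y (λ (b , t) → ⟪ rescaled (a * b) (triT s t) ⟫))
    ≈⟨ ∑-cong x (λ (a , s) → ∑-cong y (λ (b , t) → ⟪⟫-rescale (a * b) ((a * b) *_) (λ _ → refl) (triT s t))) ⟩
  ∑ x (λ (a , s) → ∑ y (λ (b , t) → (a * b) ∙ ⟪ triT s t ⟫))
    ≈⟨ ∑∑-extend x y (λ s t → ⟪ triT s t ⟫) ⟩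
  extend x (λ s → extend y (λ t → ⟪ triT s t ⟫))
    ≈⟨ extend-swap x y (λ s t → ⟪ triT s t ⟫) ⟩
  extend y (x ▷ᵗ_) ∎
  where
  open ≗-Reasoning
  rescaled : ℚ → LieExpr → LieExpr
  rescaled k = map (λ (c , r) → (k * c , r))

⟪negE⟫ : ∀ e → ⟪ negE e ⟫ ≗ (- 1ℚ) ∙ ⟪ e ⟫
⟪negE⟫ = ⟪⟫-rescale (- 1ℚ) -_ neg≡-1*
  where
  neg≡-1* : ∀ c → - c ≡ (- 1ℚ) * c
  neg≡-1* = solve-∀ ℚ-ring

∑-𝟘 : ∀ {A : Set} (xs : List A) → ∑ xs (λ _ → 𝟘) ≗ 𝟘
∑-𝟘 []       u = refl
∑-𝟘 (x ∷ xs) u = cong (0ℚ +_) (∑-𝟘 xs u)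

-- Only l = ks survives: binom(0-1, l-1) = [l = 0] and binom(1-1, l-1) = [l = 1].
∑-tuples : ∀ ks → All (_≤ 1) ks → (F : List ℕ → Series) →
           ∑ (tuples ks) (λ l → ((ℤ+ prodBinom ks l) / 1) ∙ F l) ≗ F ks
∑-tuples []                 []             F = 1∙f⊕𝟘≗f (F [])
∑-tuples (zero ∷ ks)        (_ ∷ ps)       F = begin
  ∑ (map (0 ∷_) (tuples ks) ++ []) φ
    ≈⟨ (λ u → cong (λ xs → ∑ xs φ u) (++-identityʳ (map (0 ∷_) (tuples ks)))) ⟩
  ∑ (map (0 ∷_) (tuples ks)) φ
    ≈⟨ ∑-map (0 ∷_) (tuples ks) φ ⟩
  ∑ (tuples ks) (λ l → ((ℤ+ (1 ℕ.* prodBinom ks l)) / 1) ∙ F (0 ∷ l))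
    ≈⟨ ∑-cong (tuples ks) (λ l u → cong (λ m → ((ℤ+ m) / 1) * F (0 ∷ l) u) (ℕP.*-identityˡ (prodBinom ks l))) ⟩
  ∑ (tuples ks) (λ l → ((ℤ+ prodBinom ks l) / 1) ∙ F (0 ∷ l))
    ≈⟨ ∑-tuples ks ps (F ∘ (0 ∷_)) ⟩
  F (0 ∷ ks) ∎
  where
  open ≗-Reasoning
  φ : List ℕ → Series
  φ l = ((ℤ+ prodBinom (0 ∷ ks) l) / 1) ∙ F l
∑-tuples (suc zero ∷ ks)    (_ ∷ ps)       F = begin
  ∑ (map (0 ∷_) (tuples ks) ++ map (1 ∷_) (tuples ks) ++ []) φ
    ≈⟨ ∑-++ (map (0 ∷_) (tuples ks)) (map (1 ∷_) (tuples ks) ++ []) φ ⟩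
  ∑ (map (0 ∷_) (tuples ks)) φ ⊕ ∑ (map (1 ∷_) (tuples ks) ++ []) φ
    ≈⟨ ⊕-cong vanishing (λ u → cong (λ xs → ∑ xs φ u) (++-identityʳ (map (1 ∷_) (tuples ks)))) ⟩
  𝟘 ⊕ ∑ (map (1 ∷_) (tuples ks)) φ
    ≈⟨ (λ u → ℚP.+-identityˡ _) ⟩
  ∑ (map (1 ∷_) (tuples ks)) φ
    ≈⟨ ∑-map (1 ∷_) (tuples ks) φ ⟩
  ∑ (tuples ks) (λ l → ((ℤ+ (1 ℕ.* prodBinom ks l)) / 1) ∙ F (1 ∷ l))
    ≈⟨ ∑-cong (tuples ks) (λ l u → cong (λ m → ((ℤ+ m) / 1) * F (1 ∷ l) u) (ℕP.*-identityˡ (prodBinom ks l))) ⟩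
  ∑ (tuples ks) (λ l → ((ℤ+ prodBinom ks l) / 1) ∙ F (1 ∷ l))
    ≈⟨ ∑-tuples ks ps (F ∘ (1 ∷_)) ⟩
  F (1 ∷ ks) ∎
  where
  open ≗-Reasoning
  φ : List ℕ → Series
  φ l = ((ℤ+ prodBinom (1 ∷ ks) l) / 1) ∙ F l
  vanishing : ∑ (map (0 ∷_) (tuples ks)) φ ≗ 𝟘
  vanishing u = trans (∑-map (0 ∷_) (tuples ks) φ u)
                      (trans (∑-cong (tuples ks) (λ l u → ℚP.*-zeroˡ (F (0 ∷ l) u)) u) (∑-𝟘 (tuples ks) u))
∑-tuples (suc (suc k) ∷ ks) (s≤s () ∷ _) F

sign-double : ∀ m → sign (m ℕ.+ m) ≡ 1ℚ
sign-double zero    = refl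
sign-double (suc m) rewrite ℕP.+-suc m m = sign-double m

relabel′-leaves : ∀ t r → relabel′ t (leaves t ++ r) ≡ (t , r)
relabel′-leaves (leaf i)   r = refl
relabel′-leaves (node a b) r
  rewrite ++-assoc (leaves a) (leaves b) r | relabel′-leaves a (leaves b ++ r) | relabel′-leaves b r = refl

relabel-leaves : ∀ t → relabel t (leaves t) ≡ t
relabel-leaves t = cong proj₁ (trans (cong (relabel′ t) (sym (++-identityʳ (leaves t)))) (relabel′-leaves t []))

⟪⟫-singleton : ∀ t → ⟪ (1ℚ , t) ∷ [] ⟫ ≗ ⟪ t ⟫ᵗ
⟪⟫-singleton t u = trans (⟪⟫-∷ 1ℚ t [] u) (1∙f⊕𝟘≗f ⟪ t ⟫ᵗ u)

-- Derivations on bracketings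

IsDerivation : (Tree → Series) → Set
IsDerivation D = ∀ y z → D (node y z) ≗ ⁅ D y , ⟪ z ⟫ᵗ ⁆ ⊕ ⁅ ⟪ y ⟫ᵗ , D z ⁆

derivations-agree : ∀ {P : ℕ → Set} {D D′} → IsDerivation D → IsDerivation D′ →
                    (∀ {i} → P i → D (leaf i) ≗ D′ (leaf i)) →
                    ∀ t → All P (leaves t) → D t ≗ D′ t
derivations-agree isD isD′ agree (leaf i)   (p ∷ []) = agree p
derivations-agree {P} {D} {D′} isD isD′ agree (node y z) ps = begin
  D (node y z)
    ≈⟨ isD y z ⟩
  ⁅ D y , ⟪ z ⟫ᵗ ⁆ ⊕ ⁅ ⟪ y ⟫ᵗ , D z ⁆
    ≈⟨ ⊕-cong (⁅⁆-cong {g = ⟪ z ⟫ᵗ} (agree-on y (++⁻ˡ (leaves y) ps)) (λ _ → refl))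
              (⁅⁆-cong {f = ⟪ y ⟫ᵗ} (λ _ → refl) (agree-on z (++⁻ʳ (leaves y) ps))) ⟩
  ⁅ D′ y , ⟪ z ⟫ᵗ ⁆ ⊕ ⁅ ⟪ y ⟫ᵗ , D′ z ⁆
    ≈⟨ isD′ y z ⟨
  D′ (node y z) ∎
  where
  open ≗-Reasoning
  agree-on : ∀ t → All P (leaves t) → D t ≗ D′ t
  agree-on = derivations-agree isD isD′ agree

𝟘-derivation : IsDerivation (λ _ → 𝟘)
𝟘-derivation y z u =
  sym (cong₂ _+_ (IsLinear.𝟘-homo (⁅⁆-linearˡ ⟪ z ⟫ᵗ) u) (IsLinear.𝟘-homo (⁅⁆-linearʳ ⟪ y ⟫ᵗ) u))

ad-derivation : ∀ g → IsDerivation (λ t → ⁅ ⟪ t ⟫ᵗ , g ⁆)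
ad-derivation g y z u =
  trans (⁅⁆-cong {g = g} (⟪node⟫ y z) (λ _ → refl) u) (⁅⁆-jacobi ⟪ y ⟫ᵗ ⟪ z ⟫ᵗ g u)

triT-derivation : ∀ s → IsDerivation (λ t → ⟪ triT s t ⟫)
triT-derivation s y z = begin
  ⟪ bracket (triT s y) ((1ℚ , z) ∷ []) ++ bracket ((1ℚ , y) ∷ []) (triT s z) ⟫
    ≈⟨ ⟪⟫-++ (bracket (triT s y) ((1ℚ , z) ∷ [])) (bracket ((1ℚ , y) ∷ []) (triT s z)) ⟩
  ⟪ bracket (triT s y) ((1ℚ , z) ∷ []) ⟫ ⊕ ⟪ bracket ((1ℚ , y) ∷ []) (triT s z) ⟫
    ≈⟨ ⊕-cong (λ u → trans (⟪bracket⟫ (triT s y) ((1ℚ , z) ∷ []) u)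
                           (⁅⁆-cong {f = ⟪ triT s y ⟫} (λ _ → refl) (⟪⟫-singleton z) u))
              (λ u → trans (⟪bracket⟫ ((1ℚ , y) ∷ []) (triT s z) u)
                           (⁅⁆-cong {g = ⟪ triT s z ⟫} (⟪⟫-singleton y) (λ _ → refl) u)) ⟩
  ⁅ ⟪ triT s y ⟫ , ⟪ z ⟫ᵗ ⁆ ⊕ ⁅ ⟪ y ⟫ᵗ , ⟪ triT s z ⟫ ⁆ ∎
  where open ≗-Reasoning

extend-derivation : ∀ x {Φ : Tree → Tree → Series} → (∀ s → IsDerivation (Φ s)) →
                    IsDerivation (λ t → extend x (λ s → Φ s t))
extend-derivation x {Φ} isΦ y z = begin
  extend x (λ s → Φ s (node y z))
    ≈⟨ extend-cong x (λ s → isΦ s y z) ⟩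
  extend x (λ s → ⁅ Φ s y , ⟪ z ⟫ᵗ ⁆ ⊕ ⁅ ⟪ y ⟫ᵗ , Φ s z ⁆)
    ≈⟨ extend-⊕ x (λ s → ⁅ Φ s y , ⟪ z ⟫ᵗ ⁆) (λ s → ⁅ ⟪ y ⟫ᵗ , Φ s z ⁆) ⟩
  extend x (λ s → ⁅ Φ s y , ⟪ z ⟫ᵗ ⁆) ⊕ extend x (λ s → ⁅ ⟪ y ⟫ᵗ , Φ s z ⁆)
    ≈⟨ ⊕-cong (extend-commute (⁅⁆-linearˡ ⟪ z ⟫ᵗ) x (λ s → Φ s y))
              (extend-commute (⁅⁆-linearʳ ⟪ y ⟫ᵗ) x (λ s → Φ s z)) ⟨
  ⁅ extend x (λ s → Φ s y) , ⟪ z ⟫ᵗ ⁆ ⊕ ⁅ ⟪ y ⟫ᵗ , extend x (λ s → Φ s z) ⁆ ∎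
  where open ≗-Reasoning

-- The two halves of the ari bracket

triT-leaf : ∀ s n → All (_≤ 1) (leaves s) → ⟪ triT s (leaf (suc n)) ⟫ ≗ ⟪ node (leaf (suc n)) s ⟫ᵗ
triT-leaf s n hs = begin
  ⟪ triT s (leaf (suc n)) ⟫
    ≈⟨ ⟪⟫-map (λ l → (mult k l , shape l)) (tuples k) ⟩
  ∑ (tuples k) (λ l → mult k l ∙ ⟪ shape l ⟫ᵗ)
    ≈⟨ ∑-cong (tuples k) (λ l → ∙-*-comm (sign (total k ℕ.+ total l)) _ ⟪ shape l ⟫ᵗ) ⟩
  ∑ (tuples k) (λ l → ((ℤ+ prodBinom k l) / 1) ∙ (sign (total k ℕ.+ total l) ∙ ⟪ shape l ⟫ᵗ))
    ≈⟨ ∑-tuples k hs (λ l → sign (total k ℕ.+ total l) ∙ ⟪ shape l ⟫ᵗ) ⟩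
  sign (total k ℕ.+ total k) ∙ ⟪ shape k ⟫ᵗ
    ≈⟨ (λ u → cong₂ (λ a t → a * ⟪ t ⟫ᵗ u) (sign-double (total k))
                     (cong₂ node (cong leaf (ℕP.m+n∸n≡m (suc n) (total k))) (relabel-leaves s))) ⟩
  1ℚ ∙ ⟪ node (leaf (suc n)) s ⟫ᵗ
    ≈⟨ (λ u → ℚP.*-identityˡ _) ⟩
  ⟪ node (leaf (suc n)) s ⟫ᵗ ∎
  where
  open ≗-Reasoning
  k : List ℕ
  k = leaves s
  shape : List ℕ → Tree
  shape l = node (leaf (suc n ℕ.+ total k ∸ total l)) (relabel s l)

triT-as-bracket : ∀ s t → All (_≤ 1) (leaves s) → All (1 ≤_) (leaves t) →
                  ⟪ triT s t ⟫ ≗ ⁅ ⟪ t ⟫ᵗ , ⟪ s ⟫ᵗ ⁆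
triT-as-bracket s t hs ht = derivations-agree (triT-derivation s) (ad-derivation ⟪ s ⟫ᵗ) on-generators t ht
  where
  on-generators : ∀ {i} → 1 ≤ i → ⟪ triT s (leaf i) ⟫ ≗ ⁅ ⟪ leaf i ⟫ᵗ , ⟪ s ⟫ᵗ ⁆
  on-generators {suc n} _ u = trans (triT-leaf s n hs u) (⟪node⟫ (leaf (suc n)) s u)

▷ᵗ-as-bracket : ∀ b t → InLieV0V1 b → All (1 ≤_) (leaves t) → b ▷ᵗ t ≗ ⁅ ⟪ t ⟫ᵗ , ⟪ b ⟫ ⁆
▷ᵗ-as-bracket b t hb ht = begin
  b ▷ᵗ t                             ≈⟨ extend-cong-All b hb (λ {s} hs → triT-as-bracket s t hs ht) ⟩
  extend b (λ s → ⁅ ⟪ t ⟫ᵗ , ⟪ s ⟫ᵗ ⁆)  ≈⟨ extend-commute (⁅⁆-linearʳ ⟪ t ⟫ᵗ) b ⟪_⟫ᵗ ⟨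
  ⁅ ⟪ t ⟫ᵗ , extend b ⟪_⟫ᵗ ⁆           ≈⟨ ⁅⁆-cong {f = ⟪ t ⟫ᵗ} (λ _ → refl) (⟪⟫-extend b) ⟨
  ⁅ ⟪ t ⟫ᵗ , ⟪ b ⟫ ⁆                   ∎
  where open ≗-Reasoning

▷ₐ-as-bracket : ∀ b w → InLieV0V1 b → InLieNoV0 w → ⟪ b ▷ₐ w ⟫ ≗ ⁅ ⟪ w ⟫ , ⟪ b ⟫ ⁆
▷ₐ-as-bracket b w hb hw = begin
  ⟪ b ▷ₐ w ⟫                         ≈⟨ ⟪▷ₐ⟫ b w ⟩
  extend w (b ▷ᵗ_)                   ≈⟨ extend-cong-All w hw (λ {t} ht → ▷ᵗ-as-bracket b t hb ht) ⟩
  extend w (λ t → ⁅ ⟪ t ⟫ᵗ , ⟪ b ⟫ ⁆)  ≈⟨ extend-commute (⁅⁆-linearˡ ⟪ b ⟫) w ⟪_⟫ᵗ ⟨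
  ⁅ extend w ⟪_⟫ᵗ , ⟪ b ⟫ ⁆           ≈⟨ ⁅⁆-cong {g = ⟪ b ⟫} (⟪⟫-extend w) (λ _ → refl) ⟨
  ⁅ ⟪ w ⟫ , ⟪ b ⟫ ⁆                   ∎
  where open ≗-Reasoning

▷ₐ-annihilates : ∀ w b → IsZero (w ▷ₐ v₁) → InLieV0V1 b → ⟪ w ▷ₐ b ⟫ ≗ 𝟘
▷ₐ-annihilates w b hz hb = begin
  ⟪ w ▷ₐ b ⟫                ≈⟨ ⟪▷ₐ⟫ w b ⟩
  extend b (w ▷ᵗ_)          ≈⟨ extend-cong-All b hb (λ {t} ht → derivations-agree
                                  (extend-derivation w triT-derivation) 𝟘-derivation on-generators t ht) ⟩
  extend b (λ _ → 𝟘)        ≈⟨ extend-𝟘 b ⟩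
  𝟘                         ∎
  where
  open ≗-Reasoning
  on-generators : ∀ {i} → i ≤ 1 → w ▷ᵗ leaf i ≗ 𝟘
  on-generators {zero}        _ = extend-𝟘 w
  on-generators {suc zero}    _ u = trans (sym (1∙f⊕𝟘≗f (w ▷ᵗ leaf 1) u)) (trans (sym (⟪▷ₐ⟫ w v₁ u)) (hz u))
  on-generators {suc (suc i)} (s≤s ())

proposition4p34 : (w b : LieExpr) → InLieNoV0 w → IsZero (w ▷ₐ v₁) →
                  InLieV0V1 b → IsZero (ari w b)
proposition4p34 w b hw hz hb = begin
  ⟪ ari w b ⟫
    ≈⟨ ⟪⟫-++ (w ▷ₐ b) (negE (b ▷ₐ w) ++ bracket w b) ⟩
  ⟪ w ▷ₐ b ⟫ ⊕ ⟪ negE (b ▷ₐ w) ++ bracket w b ⟫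
    ≈⟨ ⊕-cong (▷ₐ-annihilates w b hz hb) (⟪⟫-++ (negE (b ▷ₐ w)) (bracket w b)) ⟩
  𝟘 ⊕ (⟪ negE (b ▷ₐ w) ⟫ ⊕ ⟪ bracket w b ⟫)
    ≈⟨ ⊕-congˡ 𝟘 (⊕-cong (λ u → trans (⟪negE⟫ (b ▷ₐ w) u) (cong ((- 1ℚ) *_) (▷ₐ-as-bracket b w hb hw u)))
                         (⟪bracket⟫ w b)) ⟩
  𝟘 ⊕ ((- 1ℚ) ∙ ⁅ ⟪ w ⟫ , ⟪ b ⟫ ⁆ ⊕ ⁅ ⟪ w ⟫ , ⟪ b ⟫ ⁆)
    ≈⟨ (λ u → cancel (⁅ ⟪ w ⟫ , ⟪ b ⟫ ⁆ u)) ⟩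
  𝟘 ∎
  where
  open ≗-Reasoning
  cancel : ∀ x → 0ℚ + ((- 1ℚ) * x + x) ≡ 0ℚ
  cancel = solve-∀ ℚ-ring
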